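{- Let $s$ be a positive integer and let $g:\mathbb{Z}_{\ge0}\to\mathbb{Z}_{\ge0}$ be nondecreasing such that $G_g(\{y,z\})=(y\oplus(z+s))-s$ for all $y,z\in\mathbb{Z}_{\ge0}$ with $y\le g(z)$. Define $g_{ -s}(z)=g(z-s)$ for $z\ge s$ and $g_{ -s}(z)=g(0)$ for $0\le z<s$. Then $G_{g_{ -s}}(\{y,z\})=y\oplus z$ for all $y,z\in\mathbb{Z}_{\ge0}$ with $y\le g_{ -s}(z)$.
   Context: $\oplus$ denotes nim-sum (bitwise XOR). For a nondecreasing $f:\mathbb{Z}_{\ge0}\to\mathbb{Z}_{\ge0}$, positions of the chocolate bar game $CB(f,y,z)$ are pairs $\{y,z\}$ with $y\le f(z)$ (bar with $z+1$ columns, column 0 bitter, column $i$ of height $\min(f(i),y)+1$). Moves: $move_f(\{y,z\})=\{\{v,z\}:v<y\}\cup\{\{\min(y,f(w)),w\}:w<z\}$. Grundy number: $G_f(\{y,z\})=\mathrm{mex}\{G_f(p):p\in move_f(\{y,z\})\}$, mex being the least nonnegative integer not in the set. -}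

module Defs where

open import Data.Nat using (ℕ; zero; suc; _+_; _*_; _∸_; _⊓_; _≤_; _<ᵇ_; _≡ᵇ_)
open import Data.Nat.DivMod using (_/_; _%_)
open import Data.Bool using (Bool; true; false; if_then_else_; _∨_)
open import Data.List using (List; []; _∷_; _++_; [_]; length; zipWith; upTo)
open import Data.Bool.ListAction using (any)

-- Bitwise XOR (nim-sum).  xorFuel k m n computes m XOR n provided
-- k ≥ number of binary digits needed; k = m + n always suffices.
xorFuel : ℕ → ℕ → ℕ → ℕ
xorFuel zero    m n = 0
xorFuel (suc k) m n =
  (if (m % 2) ≡ᵇ (n % 2) then 0 else 1) + 2 * xorFuel k (m / 2) (n / 2)

infixl 6 _⊕_
_⊕_ : ℕ → ℕ → ℕ
m ⊕ n = xorFuel (m + n) m n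

_∈ᵇ_ : ℕ → List ℕ → Bool
k ∈ᵇ xs = any (λ x → k ≡ᵇ x) xs

mexFrom : ℕ → ℕ → List ℕ → ℕ
mexFrom zero    k xs = k
mexFrom (suc n) k xs = if k ∈ᵇ xs then mexFrom n (suc k) xs else k

mex : List ℕ → ℕ
mex xs = mexFrom (length xs) 0 xs

NonDecreasing : (ℕ → ℕ) → Set
NonDecreasing f = ∀ a b → a ≤ b → f a ≤ f b

-- Grundy numbers of CB(f,y,z).  A position {y,z} has options
--   {v,z} for v < y   and   {min(y,f w), w} for w < z.
-- cols: the Grundy functions y ↦ G_f({y,w}) for w = 0,…,z-1 (in order).
module _ (f : ℕ → ℕ) where
  sideOpts : ℕ → List (ℕ → ℕ) → ℕ → List ℕ
  sideOpts z cols y = zipWith (λ w c → c (y ⊓ f w)) (upTo z) cols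

  colVals : ℕ → List (ℕ → ℕ) → ℕ → List ℕ
  colVals z cols zero    = []
  colVals z cols (suc y) =
    colVals z cols y ++ [ mex (colVals z cols y ++ sideOpts z cols y) ]

  column : ℕ → List (ℕ → ℕ) → ℕ → ℕ
  column z cols y = mex (colVals z cols y ++ sideOpts z cols y)

  columns : ℕ → List (ℕ → ℕ)
  columns zero    = []
  columns (suc z) = columns z ++ [ column z (columns z) ]

  -- G_f({y,z})  (meaningful for positions, i.e. y ≤ f z)
  grundy : ℕ → ℕ → ℕ
  grundy y z = column z (columns z) y

shiftFn : ℕ → (ℕ → ℕ) → ℕ → ℕ
shiftFn s g z = if z <ᵇ s then g 0 else g (z ∸ s)

-- Column 0 of every chocolate bar is a Nim heap, so the hypothesis at z = 0 says that
-- each y ≤ g(0) is added to s without carries. Such a y commutes with translation by s,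
-- y ⊕ (z + s) = (y ⊕ z) + s, and y ⊕ _ permutes [0, s). In the first s columns g₋ₛ is
-- the constant g(0) ≥ y, so there the game coincides with CB(g) and the hypothesis gives
-- G = y ⊕ z at once. In column z + s, by induction, the options of {y, z + s} have the
-- values G_g(p) + s for the options p of {y, z} in CB(g), together with all of [0, s)
-- (from the options {y ⊓ g(0), w}, w < s); so their mex is G_g({y, z}) + s = y ⊕ (z + s).

module Submission where

open import Defs
open import Data.Bool using (Bool; true; false; _xor_; if_then_else_)
open import Data.Bool.Properties using (T-≡; xor-assoc; xor-same)
open import Data.Empty using (⊥; ⊥-elim)
open import Data.Fin using (Fin; toℕ)
open import Data.Fin.Properties using (pigeonhole; toℕ<n)
open import Data.List using (List; _∷_; _++_; _∷ʳ_; length; lookup; applyUpTo; upTo; zipWith)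
open import Data.List.Properties using (applyUpTo-∷ʳ)
open import Data.List.Membership.Propositional using (_∈_; _∉_)
open import Data.List.Membership.Propositional.Properties
  using (∈-++⁺ˡ; ∈-++⁺ʳ; ∈-++⁻; ∈-applyUpTo⁺; ∈-applyUpTo⁻)
open import Data.List.Relation.Unary.Any as Any using ()
open import Data.List.Relation.Unary.Any.Properties using (any⁺; any⁻; lookup-index)
open import Data.Nat
  using (ℕ; zero; suc; _+_; _*_; _∸_; _⊓_; _≤_; _<_; z≤n; s≤s; s<s; _≡ᵇ_; _<ᵇ_; NonZero)
open import Data.Nat.DivMod
  using (_/_; _%_; [m+kn]%n≡m%n; m*n%n≡0; +-distrib-/; m*n/n≡m; m/n*n≤m; m/n≤m)
open import Data.Nat.Induction using (<-rec)
open import Data.Nat.Properties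
open import Data.Product using (_,_; ∃; ∃₂; _×_)
open import Data.Sum using (_⊎_; inj₁; inj₂)
open import Function using (_∘_; id)
open import Function.Bundles using (Equivalence)
open import Relation.Binary.Definitions using (tri<; tri≈; tri>)
open import Relation.Binary.PropositionalEquality
  using (_≡_; _≢_; refl; sym; trans; cong; cong₂; subst; module ≡-Reasoning)
open import Relation.Nullary using (yes; no; contradiction)

digit : Bool → ℕ
digit false = 0
digit true  = 1

data Binary : ℕ → Set where
  zero  : Binary 0
  _+2*_ : ∀ {n} (b : Bool) → Binary n → Binary (digit b + 2 * n)

suc-binary : ∀ {n} → Binary n → Binary (suc n)
suc-binary zero           = true +2* zero
suc-binary (false +2* bs) = true +2* bs
suc-binary (true +2* bs)  = subst Binary (*-suc 2 _) (false +2* suc-binary bs)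

binary : ∀ n → Binary n
binary zero    = zero
binary (suc n) = suc-binary (binary n)

data Halving : ℕ → Set where
  _+2*_ : (b : Bool) (q : ℕ) → Halving (digit b + 2 * q)

halving : ∀ n → Halving n
halving n = halve (binary n)
  where
  halve : ∀ {n} → Binary n → Halving n
  halve zero            = false +2* 0
  halve (_+2*_ {q} b _) = b +2* q

xorFuel-0-0 : ∀ k → xorFuel k 0 0 ≡ 0
xorFuel-0-0 zero    = refl
xorFuel-0-0 (suc k) = cong (2 *_) (xorFuel-0-0 k)

2*m≤1+n⇒m≤n : ∀ {m n} → 2 * m ≤ suc n → m ≤ n
2*m≤1+n⇒m≤n {zero}  _ = z≤n
2*m≤1+n⇒m≤n {suc m} (s≤s 2m+1≤n) =
  ≤-trans (m≤n+m (suc m) m) (subst (λ x → m + suc x ≤ _) (+-identityʳ m) 2m+1≤n)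

halves-≤ : ∀ m n {k} → m + n ≤ suc k → m / 2 + n / 2 ≤ k
halves-≤ m n m+n≤1+k = 2*m≤1+n⇒m≤n (≤-trans twice-halves m+n≤1+k)
  where
  twice-halves : 2 * (m / 2 + n / 2) ≤ m + n
  twice-halves = subst (_≤ m + n) (sym (*-distribˡ-+ 2 (m / 2) (n / 2)))
    (+-mono-≤ (subst (_≤ m) (*-comm (m / 2) 2) (m/n*n≤m m 2))
              (subst (_≤ n) (*-comm (n / 2) 2) (m/n*n≤m n 2)))

xorFuel-stable : ∀ k k′ m n → m + n ≤ k → m + n ≤ k′ → xorFuel k m n ≡ xorFuel k′ m n
xorFuel-stable zero    zero     _    _    _ _ = refl
xorFuel-stable zero    (suc k′) zero zero _ _ = sym (cong (2 *_) (xorFuel-0-0 k′))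
xorFuel-stable (suc k) zero     zero zero _ _ = cong (2 *_) (xorFuel-0-0 k)
xorFuel-stable (suc k) (suc k′) m    n    p q =
  cong (λ x → (if m % 2 ≡ᵇ n % 2 then 0 else 1) + 2 * x)
       (xorFuel-stable k k′ (m / 2) (n / 2) (halves-≤ m n p) (halves-≤ m n q))

⊕-unfold : ∀ m n → m ⊕ n ≡ (if m % 2 ≡ᵇ n % 2 then 0 else 1) + 2 * (m / 2 ⊕ n / 2)
⊕-unfold m n =
  trans (xorFuel-stable (m + n) (suc (m + n)) m n ≤-refl (n≤1+n _))
        (cong (λ x → (if m % 2 ≡ᵇ n % 2 then 0 else 1) + 2 * x)
              (xorFuel-stable (m + n) (m / 2 + n / 2) (m / 2) (n / 2)
                 (+-mono-≤ (m/n≤m m 2) (m/n≤m n 2)) ≤-refl))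

digit-%2 : ∀ b a → (digit b + 2 * a) % 2 ≡ digit b
digit-%2 false a = trans (cong (_% 2) (*-comm 2 a)) ([m+kn]%n≡m%n 0 a 2)
digit-%2 true  a = trans (cong (λ x → (1 + x) % 2) (*-comm 2 a)) ([m+kn]%n≡m%n 1 a 2)

digit-/2 : ∀ b a → (digit b + 2 * a) / 2 ≡ a
digit-/2 b a = begin
  (digit b + 2 * a) / 2      ≡⟨ cong (λ x → (digit b + x) / 2) (*-comm 2 a) ⟩
  (digit b + a * 2) / 2      ≡⟨ +-distrib-/ (digit b) (a * 2) no-carry ⟩
  digit b / 2 + a * 2 / 2    ≡⟨ cong₂ _+_ (digit/2≡0 b) (m*n/n≡m a 2) ⟩
  a                          ∎
  where
  open ≡-Reasoning
  digit/2≡0 : ∀ b → digit b / 2 ≡ 0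
  digit/2≡0 false = refl
  digit/2≡0 true  = refl
  digit%2<2 : ∀ b → digit b % 2 + 0 < 2
  digit%2<2 false = s≤s z≤n
  digit%2<2 true  = s≤s (s≤s z≤n)
  no-carry : digit b % 2 + a * 2 % 2 < 2
  no-carry = subst (λ r → digit b % 2 + r < 2) (sym (m*n%n≡0 a 2)) (digit%2<2 b)

⊕-digits : ∀ b c a d → (digit b + 2 * a) ⊕ (digit c + 2 * d) ≡ digit (b xor c) + 2 * (a ⊕ d)
⊕-digits b c a d
  rewrite ⊕-unfold (digit b + 2 * a) (digit c + 2 * d)
        | digit-%2 b a | digit-%2 c d | digit-/2 b a | digit-/2 c d
  = cong (_+ 2 * (a ⊕ d)) (bit-xor b c)
  where
  bit-xor : ∀ b c → (if digit b ≡ᵇ digit c then 0 else 1) ≡ digit (b xor c)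
  bit-xor false false = refl
  bit-xor false true  = refl
  bit-xor true  false = refl
  bit-xor true  true  = refl

0⊕n≡n : ∀ n → 0 ⊕ n ≡ n
0⊕n≡n n = go (binary n)
  where
  go : ∀ {n} → Binary n → 0 ⊕ n ≡ n
  go zero             = refl
  go (_+2*_ {q} b bs) = trans (⊕-digits false b 0 q) (cong (λ x → digit b + 2 * x) (go bs))

m⊕[m⊕n]≡n : ∀ m n → m ⊕ (m ⊕ n) ≡ n
m⊕[m⊕n]≡n m = go (binary m)
  where
  open ≡-Reasoning
  go : ∀ {m} → Binary m → ∀ n → m ⊕ (m ⊕ n) ≡ n
  go zero n = trans (0⊕n≡n (0 ⊕ n)) (0⊕n≡n n)
  go (_+2*_ {a} b bs) n with halving n
  ... | c +2* d = begin
    (digit b + 2 * a) ⊕ ((digit b + 2 * a) ⊕ (digit c + 2 * d))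
      ≡⟨ cong ((digit b + 2 * a) ⊕_) (⊕-digits b c a d) ⟩
    (digit b + 2 * a) ⊕ (digit (b xor c) + 2 * (a ⊕ d))
      ≡⟨ ⊕-digits b (b xor c) a (a ⊕ d) ⟩
    digit (b xor (b xor c)) + 2 * (a ⊕ (a ⊕ d))
      ≡⟨ cong₂ (λ x y → digit x + 2 * y) b⊻[b⊻c]≡c (go bs d) ⟩
    digit c + 2 * d ∎
    where
    b⊻[b⊻c]≡c : b xor (b xor c) ≡ c
    b⊻[b⊻c]≡c = trans (sym (xor-assoc b b c)) (cong (_xor c) (xor-same b))

-- For s > 0 this says y < 2^ν, where 2^ν is the largest power of 2 dividing s.
CarryFreeUpTo : ℕ → ℕ → Set
CarryFreeUpTo y s = ∀ {x} → x ≤ y → x ⊕ s ≡ x + s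

carryFree-odd : ∀ {y q} → CarryFreeUpTo y (digit true + 2 * q) → y ≡ 0
carryFree-odd {zero}      _  = refl
carryFree-odd {suc _} {q} cf = ⊥-elim (<-irrefl 2q≡2+2q (m<n⇒m<1+n (n<1+n (2 * q))))
  where
  2q≡2+2q : 2 * q ≡ 2 + 2 * q
  2q≡2+2q = begin
    2 * q             ≡⟨ cong (2 *_) (0⊕n≡n q) ⟨
    2 * (0 ⊕ q)       ≡⟨ ⊕-digits true true 0 q ⟨
    1 ⊕ (1 + 2 * q)   ≡⟨ cf (s≤s z≤n) ⟩
    2 + 2 * q         ∎
    where open ≡-Reasoning

carryFree-half : ∀ {b a s} → CarryFreeUpTo (digit b + 2 * a) (2 * s) → CarryFreeUpTo a s
carryFree-half {b} {a} {s} cf {x} x≤a = *-cancelˡ-≡ (x ⊕ s) (x + s) 2 (begin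
  2 * (x ⊕ s)    ≡⟨ ⊕-digits false false x s ⟨
  2 * x ⊕ 2 * s  ≡⟨ cf (≤-trans (*-monoʳ-≤ 2 x≤a) (m≤n+m (2 * a) (digit b))) ⟩
  2 * x + 2 * s  ≡⟨ *-distribˡ-+ 2 x s ⟨
  2 * (x + s)    ∎)
  where open ≡-Reasoning

digit+2*-< : ∀ b {x n} → x < n → digit b + 2 * x < 2 * n
digit+2*-< b {x} {n} x<n = <-≤-trans (digit-< b) (subst (_≤ 2 * n) (*-suc 2 x) (*-monoʳ-≤ 2 x<n))
  where
  digit-< : ∀ b → digit b + 2 * x < 2 + 2 * x
  digit-< false = s≤s (n≤1+n _)
  digit-< true  = ≤-refl

carryFree⇒⊕< : ∀ {s y w} → CarryFreeUpTo y s → w < s → y ⊕ w < s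
carryFree⇒⊕< {s} = go (binary s)
  where
  go : ∀ {s y w} → Binary s → CarryFreeUpTo y s → w < s → y ⊕ w < s
  go zero _ ()
  go {w = w} (_+2*_ {q} true _) cf w<s rewrite carryFree-odd {q = q} cf =
    subst (_< _) (sym (0⊕n≡n w)) w<s
  go {y = y} {w} (_+2*_ {s′} false bs) cf w<s with halving y | halving w
  ... | b +2* a | c +2* d =
    subst (_< 2 * s′) (sym (⊕-digits b c a d))
          (digit+2*-< (b xor c) (go bs (carryFree-half {b} {a} cf) d<s′))
    where
    d<s′ : d < s′
    d<s′ = *-cancelˡ-< 2 d s′ (≤-<-trans (m≤n+m (2 * d) (digit c)) w<s)

carryFree⇒⊕+ : ∀ {s y} → CarryFreeUpTo y s → ∀ z → y ⊕ (z + s) ≡ y ⊕ z + s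
carryFree⇒⊕+ {s} = go (binary s)
  where
  open ≡-Reasoning
  regroup : ∀ b x y → digit b + 2 * x + 2 * y ≡ digit b + 2 * (x + y)
  regroup b x y = trans (+-assoc (digit b) _ _) (cong (digit b +_) (sym (*-distribˡ-+ 2 x y)))
  go : ∀ {s y} → Binary s → CarryFreeUpTo y s → ∀ z → y ⊕ (z + s) ≡ y ⊕ z + s
  go {y = y} zero _ z = trans (cong (y ⊕_) (+-identityʳ z)) (sym (+-identityʳ _))
  go (_+2*_ {q} true _) cf z rewrite carryFree-odd {q = q} cf =
    trans (0⊕n≡n _) (cong (_+ _) (sym (0⊕n≡n z)))
  go {y = y} (_+2*_ {s′} false bs) cf z with halving y | halving z
  ... | b +2* a | c +2* d = begin
    (digit b + 2 * a) ⊕ (digit c + 2 * d + 2 * s′)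
      ≡⟨ cong ((digit b + 2 * a) ⊕_) (regroup c d s′) ⟩
    (digit b + 2 * a) ⊕ (digit c + 2 * (d + s′))
      ≡⟨ ⊕-digits b c a (d + s′) ⟩
    digit (b xor c) + 2 * (a ⊕ (d + s′))
      ≡⟨ cong (λ x → digit (b xor c) + 2 * x) (go bs (carryFree-half {b} {a} cf) d) ⟩
    digit (b xor c) + 2 * (a ⊕ d + s′)
      ≡⟨ regroup (b xor c) (a ⊕ d) s′ ⟨
    digit (b xor c) + 2 * (a ⊕ d) + 2 * s′
      ≡⟨ cong (_+ 2 * s′) (⊕-digits b c a d) ⟨
    (digit b + 2 * a) ⊕ (digit c + 2 * d) + 2 * s′ ∎

∈ᵇ⇒∈ : ∀ {k xs} → k ∈ᵇ xs ≡ true → k ∈ xs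
∈ᵇ⇒∈ {k} {xs} k∈ᵇxs = Any.map (λ {x} → ≡ᵇ⇒≡ k x) (any⁻ _ xs (Equivalence.from T-≡ k∈ᵇxs))

∈⇒∈ᵇ : ∀ {k xs} → k ∈ xs → k ∈ᵇ xs ≡ true
∈⇒∈ᵇ {k} k∈xs = Equivalence.to T-≡ (any⁺ _ (Any.map (λ {x} → ≡⇒≡ᵇ k x) k∈xs))

below⊆⇒≤length : ∀ {n xs} → (∀ {j} → j < n → j ∈ xs) → n ≤ length xs
below⊆⇒≤length {n} {xs} below∈ with n ≤? length xs
... | yes n≤len = n≤len
... | no  n≰len = ⊥-elim (collision (pigeonhole (≰⇒> n≰len) position))
  where
  position : Fin n → Fin (length xs)
  position i = Any.index (below∈ (toℕ<n i))
  collision : ∃₂ (λ i j → toℕ i < toℕ j × position i ≡ position j) → ⊥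
  collision (i , j , i<j , same) = <-irrefl toℕi≡toℕj i<j
    where
    toℕi≡toℕj : toℕ i ≡ toℕ j
    toℕi≡toℕj = trans (lookup-index (below∈ (toℕ<n i)))
                  (trans (cong (lookup xs) same) (sym (lookup-index (below∈ (toℕ<n j)))))

mexFrom-< : ∀ n {k j xs} → k ≤ j → j < mexFrom n k xs → j ∈ xs
mexFrom-< zero k≤j j<k = ⊥-elim (<⇒≱ j<k k≤j)
mexFrom-< (suc n) {k} {xs = xs} k≤j j<mex with k ∈ᵇ xs in k∈ᵇxs
... | false = ⊥-elim (<⇒≱ j<mex k≤j)
... | true with m≤n⇒m<n∨m≡n k≤j
...   | inj₁ k<j  = mexFrom-< n k<j j<mex
...   | inj₂ refl = ∈ᵇ⇒∈ k∈ᵇxs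

mexFrom-∈ : ∀ n {k xs} → mexFrom n k xs ∈ xs → mexFrom n k xs ≡ n + k
mexFrom-∈ zero    _ = refl
mexFrom-∈ (suc n) {k} {xs} mex∈xs with k ∈ᵇ xs in k∈ᵇxs
... | true  = trans (mexFrom-∈ n mex∈xs) (+-suc n k)
... | false = contradiction (trans (sym k∈ᵇxs) (∈⇒∈ᵇ mex∈xs)) λ ()

mex-< : ∀ {j xs} → j < mex xs → j ∈ xs
mex-< {xs = xs} = mexFrom-< (length xs) z≤n

mex-∉ : ∀ xs → mex xs ∉ xs
mex-∉ xs mex∈xs = <-irrefl refl (below⊆⇒≤length upToMex)
  where
  mex≡length : mex xs ≡ length xs
  mex≡length = trans (mexFrom-∈ (length xs) mex∈xs) (+-identityʳ _)
  upToMex : ∀ {j} → j < suc (length xs) → j ∈ xs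
  upToMex j<1+len with m≤n⇒m<n∨m≡n (≤-pred j<1+len)
  ... | inj₁ j<len = mex-< (subst (_ <_) (sym mex≡length) j<len)
  ... | inj₂ refl  = subst (_∈ xs) mex≡length mex∈xs

applyUpTo-cong : ∀ {A : Set} {f g : ℕ → A} n → (∀ {i} → i < n → f i ≡ g i) →
                 applyUpTo f n ≡ applyUpTo g n
applyUpTo-cong zero    _   = refl
applyUpTo-cong (suc n) f≗g = cong₂ _∷_ (f≗g (s≤s z≤n)) (applyUpTo-cong n (f≗g ∘ s<s))

zipWith-applyUpTo : ∀ {A B C : Set} (F : A → B → C) a b n →
                    zipWith F (applyUpTo a n) (applyUpTo b n) ≡ applyUpTo (λ i → F (a i) (b i)) n
zipWith-applyUpTo F a b zero    = refl
zipWith-applyUpTo F a b (suc n) = cong (F (a 0) (b 0) ∷_) (zipWith-applyUpTo F (a ∘ suc) (b ∘ suc) n)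

⊓-agree-≤ : ∀ {m n o p} → m ≤ n → n ⊓ o ≡ n ⊓ p → m ⊓ o ≡ m ⊓ p
⊓-agree-≤ {m} {n} {o} {p} m≤n n⊓o≡n⊓p = begin
  m ⊓ o        ≡⟨ cong (_⊓ o) (m≤n⇒m⊓n≡m m≤n) ⟨
  m ⊓ n ⊓ o    ≡⟨ ⊓-assoc m n o ⟩
  m ⊓ (n ⊓ o)  ≡⟨ cong (m ⊓_) n⊓o≡n⊓p ⟩
  m ⊓ (n ⊓ p)  ≡⟨ ⊓-assoc m n p ⟨
  m ⊓ n ⊓ p    ≡⟨ cong (_⊓ p) (m≤n⇒m⊓n≡m m≤n) ⟩
  m ⊓ p        ∎
  where open ≡-Reasoning

data Move (f : ℕ → ℕ) (y z : ℕ) : ℕ → ℕ → Set where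
  lower  : ∀ {v} → v < y → Move f y z v z
  narrow : ∀ {w} → w < z → Move f y z (y ⊓ f w) w

module _ (f : ℕ → ℕ) where

  OptionWithValue : ℕ → ℕ → ℕ → Set
  OptionWithValue y z j = ∃₂ λ v w → Move f y z v w × grundy f v w ≡ j

  Move-≤ : ∀ {y z v w} → y ≤ f z → Move f y z v w → v ≤ f w
  Move-≤ y≤fz (lower v<y)  = ≤-trans (<⇒≤ v<y) y≤fz
  Move-≤ {y} _ (narrow {w} _) = m⊓n≤n y (f w)

  move-induction : (P : ℕ → ℕ → Set) →
                   (∀ y z → (∀ {v w} → Move f y z v w → P v w) → P y z) → ∀ y z → P y z
  move-induction P step y z = <-rec (λ z → ∀ y → P y z) outer z y
    where
    outer : ∀ z → (∀ {w} → w < z → ∀ y → P y w) → ∀ y → P y z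
    outer z left-of-z = <-rec (λ y → P y z) λ y below-y →
      step y z λ { (lower v<y) → below-y v<y ; (narrow w<z) → left-of-z w<z _ }

  options : ℕ → ℕ → List ℕ
  options y z = applyUpTo (λ v → grundy f v z) y ++ applyUpTo (λ w → grundy f (y ⊓ f w) w) z

  columns-applyUpTo : ∀ z → columns f z ≡ applyUpTo (λ w → column f w (columns f w)) z
  columns-applyUpTo zero    = refl
  columns-applyUpTo (suc z) =
    trans (cong (_∷ʳ column f z (columns f z)) (columns-applyUpTo z)) (applyUpTo-∷ʳ _ z)

  grundy≡mex-options : ∀ y z → grundy f y z ≡ mex (options y z)
  grundy≡mex-options y z = cong mex (cong₂ _++_ (colVals-applyUpTo y) sideOpts-applyUpTo)
    where
    colVals-applyUpTo : ∀ y → colVals f z (columns f z) y ≡ applyUpTo (λ v → grundy f v z) y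
    colVals-applyUpTo zero    = refl
    colVals-applyUpTo (suc y) =
      trans (cong (_∷ʳ grundy f y z) (colVals-applyUpTo y)) (applyUpTo-∷ʳ _ y)
    sideOpts-applyUpTo : sideOpts f z (columns f z) y ≡ applyUpTo (λ w → grundy f (y ⊓ f w) w) z
    sideOpts-applyUpTo = trans (cong (zipWith _ (upTo z)) (columns-applyUpTo z))
                               (zipWith-applyUpTo _ id _ z)

  ∈-options⁺ : ∀ {y z v w} → Move f y z v w → grundy f v w ∈ options y z
  ∈-options⁺ (lower v<y)  = ∈-++⁺ˡ (∈-applyUpTo⁺ _ v<y)
  ∈-options⁺ (narrow w<z) = ∈-++⁺ʳ _ (∈-applyUpTo⁺ _ w<z)

  ∈-options⁻ : ∀ {y z j} → j ∈ options y z → OptionWithValue y z j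
  ∈-options⁻ {y} {z} j∈ with ∈-++⁻ (applyUpTo (λ v → grundy f v z) y) j∈
  ... | inj₁ j∈lower  with v , v<y , refl ← ∈-applyUpTo⁻ _ j∈lower  = v , z , lower v<y , refl
  ... | inj₂ j∈narrow with w , w<z , refl ← ∈-applyUpTo⁻ _ j∈narrow = _ , w , narrow w<z , refl

  grundy-move-≢ : ∀ {y z v w} → Move f y z v w → grundy f v w ≢ grundy f y z
  grundy-move-≢ {y} {z} mv same =
    mex-∉ (options y z) (subst (_∈ options y z) (trans same (grundy≡mex-options y z)) (∈-options⁺ mv))

  grundy-move-< : ∀ {y z j} → j < grundy f y z → OptionWithValue y z j
  grundy-move-< {y} {z} j<G = ∈-options⁻ (mex-< (subst (_ <_) (grundy≡mex-options y z) j<G))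

  grundy-unique : ∀ {y z t} → (∀ {v w} → Move f y z v w → grundy f v w ≢ t) →
                  (∀ {j} → j < t → OptionWithValue y z j) → grundy f y z ≡ t
  grundy-unique {y} {z} {t} avoids reaches with <-cmp (grundy f y z) t
  ... | tri< G<t _ _ = let _ , _ , mv , value = reaches G<t in ⊥-elim (grundy-move-≢ mv value)
  ... | tri≈ _ G≡t _ = G≡t
  ... | tri> _ _ t<G = let _ , _ , mv , value = grundy-move-< t<G in ⊥-elim (avoids mv value)

  grundy-column₀ : ∀ y → grundy f y 0 ≡ y
  grundy-column₀ = <-rec _ λ y ih → grundy-unique
    (λ { (lower v<y) G≡y → <-irrefl (trans (sym (ih v<y)) G≡y) v<y ; (narrow ()) })
    (λ j<y → _ , 0 , lower j<y , ih j<y)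

grundy-cong : ∀ {f₁ f₂} y z → (∀ {w} → w < z → y ⊓ f₁ w ≡ y ⊓ f₂ w) →
              grundy f₁ y z ≡ grundy f₂ y z
grundy-cong {f₁} {f₂} = move-induction f₁ Agree⇒≡ λ y z ih agree → begin
  grundy f₁ y z         ≡⟨ grundy≡mex-options f₁ y z ⟩
  mex (options f₁ y z)  ≡⟨ cong mex (cong₂ _++_
                             (applyUpTo-cong y λ v<y → ih (lower v<y) (⊓-agree-≤ (<⇒≤ v<y) ∘ agree))
                             (applyUpTo-cong z λ w<z → narrowed ih agree w<z)) ⟩
  mex (options f₂ y z)  ≡⟨ grundy≡mex-options f₂ y z ⟨
  grundy f₂ y z         ∎
  where
  open ≡-Reasoning
  Agree⇒≡ : ℕ → ℕ → Set
  Agree⇒≡ y z = (∀ {w} → w < z → y ⊓ f₁ w ≡ y ⊓ f₂ w) → grundy f₁ y z ≡ grundy f₂ y z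
  narrowed : ∀ {y z w} → (∀ {v w} → Move f₁ y z v w → Agree⇒≡ v w) →
             (∀ {w} → w < z → y ⊓ f₁ w ≡ y ⊓ f₂ w) → w < z →
             grundy f₁ (y ⊓ f₁ w) w ≡ grundy f₂ (y ⊓ f₂ w) w
  narrowed {y} {w = w} ih agree w<z = trans
    (ih (narrow w<z) λ w′<w → ⊓-agree-≤ (m⊓n≤m y (f₁ w)) (agree (<-trans w′<w w<z)))
    (cong (λ u → grundy f₂ u w) (agree w<z))

data ShiftSplit (s : ℕ) : ℕ → Set where
  below : ∀ {z} → z < s → ShiftSplit s z
  above : ∀ z → ShiftSplit s (z + s)

shiftSplit : ∀ s z → ShiftSplit s z
shiftSplit s z with z <? s
... | yes z<s = below z<s
... | no  z≮s = subst (ShiftSplit s) (m∸n+n≡m (≮⇒≥ z≮s)) (above (z ∸ s))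

module ShiftedGame (s : ℕ) (g : ℕ → ℕ) where

  g₋ₛ : ℕ → ℕ
  g₋ₛ = shiftFn s g

  g₋ₛ-below : ∀ {z} → z < s → g₋ₛ z ≡ g 0
  g₋ₛ-below {z} z<s with z <ᵇ s | <⇒<ᵇ z<s
  ... | true  | _  = refl
  ... | false | ()

  g₋ₛ-above : ∀ z → g₋ₛ (z + s) ≡ g z
  g₋ₛ-above z with (z + s) <ᵇ s in z+s<ᵇs
  ... | true  = ⊥-elim (<⇒≱ (<ᵇ⇒< (z + s) s (Equivalence.from T-≡ z+s<ᵇs)) (m≤n+m s z))
  ... | false = cong g (m+n∸n≡m z s)

  lift-move : ∀ {y z v w} → Move g y z v w → Move g₋ₛ y (z + s) v (w + s)
  lift-move (lower v<y) = lower v<y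
  lift-move {y} {z} (narrow {w} w<z) =
    subst (λ u → Move g₋ₛ y (z + s) u (w + s)) (cong (y ⊓_) (g₋ₛ-above w))
          (narrow (+-monoˡ-< s w<z))

  move-cases : ∀ {y z v w} → Move g₋ₛ y (z + s) v w →
               (w < s × v ≡ y ⊓ g 0) ⊎ ∃ λ w′ → w ≡ w′ + s × Move g y z v w′
  move-cases {z = z} (lower v<y) = inj₂ (z , refl , lower v<y)
  move-cases {y} {z} (narrow {w} w<z+s) with shiftSplit s w
  ... | below w<s = inj₁ (w<s , cong (y ⊓_) (g₋ₛ-below w<s))
  ... | above w′  = inj₂ (w′ , refl , subst (λ u → Move g y z u w′) (cong (y ⊓_) (sym (g₋ₛ-above w′)))
                                               (narrow (+-cancelʳ-< s w′ z w<z+s)))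

  module _ (g-mono : NonDecreasing g)
           (shifted : ∀ y z → y ≤ g z → grundy g y z + s ≡ y ⊕ (z + s)) where

    carryFree : ∀ {y} → y ≤ g 0 → CarryFreeUpTo y s
    carryFree y≤g0 {x} x≤y = begin
      x ⊕ s             ≡⟨ shifted x 0 (≤-trans x≤y y≤g0) ⟨
      grundy g x 0 + s  ≡⟨ cong (_+ s) (grundy-column₀ g x) ⟩
      x + s             ∎
      where open ≡-Reasoning

    grundy-initial : ∀ {y z} → z < s → y ≤ g 0 → grundy g₋ₛ y z ≡ y ⊕ z
    grundy-initial {y} {z} z<s y≤g0 = +-cancelʳ-≡ s _ _ (begin
      grundy g₋ₛ y z + s  ≡⟨ cong (_+ s) (grundy-cong y z agree) ⟩
      grundy g y z + s    ≡⟨ shifted y z (≤-trans y≤g0 (g-mono 0 z z≤n)) ⟩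
      y ⊕ (z + s)         ≡⟨ carryFree⇒⊕+ (carryFree y≤g0) z ⟩
      y ⊕ z + s           ∎)
      where
      open ≡-Reasoning
      agree : ∀ {w} → w < z → y ⊓ g₋ₛ w ≡ y ⊓ g w
      agree {w} w<z = begin
        y ⊓ g₋ₛ w  ≡⟨ cong (y ⊓_) (g₋ₛ-below (<-trans w<z z<s)) ⟩
        y ⊓ g 0    ≡⟨ m≤n⇒m⊓n≡m y≤g0 ⟩
        y          ≡⟨ m≤n⇒m⊓n≡m (≤-trans y≤g0 (g-mono 0 w z≤n)) ⟨
        y ⊓ g w    ∎

    grundy-shifted : ∀ {y z} → y ≤ g z →
                     (∀ {v w} → Move g₋ₛ y (z + s) v w → grundy g₋ₛ v w ≡ v ⊕ w) →
                     grundy g₋ₛ y (z + s) ≡ y ⊕ (z + s)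
    grundy-shifted {y} {z} y≤gz nim = trans (grundy-unique g₋ₛ avoids reaches) (shifted y z y≤gz)
      where
      open ≡-Reasoning
      lifted-value : ∀ {v w} → Move g y z v w → grundy g₋ₛ v (w + s) ≡ grundy g v w + s
      lifted-value mv = trans (nim (lift-move mv)) (sym (shifted _ _ (Move-≤ g y≤gz mv)))

      initial-carryFree : CarryFreeUpTo (y ⊓ g 0) s
      initial-carryFree = carryFree (m⊓n≤n y (g 0))

      avoids : ∀ {v w} → Move g₋ₛ y (z + s) v w → grundy g₋ₛ v w ≢ grundy g y z + s
      avoids mv G≡ with move-cases mv
      ... | inj₁ (w<s , refl) =
        <⇒≱ (subst (_< s) (trans (sym (nim mv)) G≡) (carryFree⇒⊕< initial-carryFree w<s))
            (m≤n+m s _)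
      ... | inj₂ (_ , refl , mv′) =
        grundy-move-≢ g mv′ (+-cancelʳ-≡ s _ _ (trans (sym (lifted-value mv′)) G≡))

      reaches : ∀ {j} → j < grundy g y z + s → OptionWithValue g₋ₛ y (z + s) j
      reaches {j} j< with shiftSplit s j
      ... | below j<s = _ , w , narrow w<z+s , value
        where
        w : ℕ
        w = (y ⊓ g 0) ⊕ j
        w<s : w < s
        w<s = carryFree⇒⊕< initial-carryFree j<s
        w<z+s : w < z + s
        w<z+s = <-≤-trans w<s (m≤n+m s z)
        value : grundy g₋ₛ (y ⊓ g₋ₛ w) w ≡ j
        value = begin
          grundy g₋ₛ (y ⊓ g₋ₛ w) w  ≡⟨ nim (narrow w<z+s) ⟩
          (y ⊓ g₋ₛ w) ⊕ w           ≡⟨ cong (λ u → (y ⊓ u) ⊕ w) (g₋ₛ-below w<s) ⟩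
          (y ⊓ g 0) ⊕ w             ≡⟨ m⊕[m⊕n]≡n (y ⊓ g 0) j ⟩
          j                         ∎
      ... | above j′ =
        let v , w , mv , value = grundy-move-< g (+-cancelʳ-< s j′ _ j<)
        in  v , w + s , lift-move mv , trans (lifted-value mv) (cong (_+ s) value)

mainTheorem5 : (s : ℕ) → NonZero s → (g : ℕ → ℕ) → NonDecreasing g →
    (∀ y z → y ≤ g z → grundy g y z + s ≡ y ⊕ (z + s)) →
    ∀ y z → y ≤ shiftFn s g z → grundy (shiftFn s g) y z ≡ y ⊕ z
mainTheorem5 s _ g g-mono shifted = move-induction g₋ₛ NimSum nim-sum
  where
  open ShiftedGame s g
  NimSum : ℕ → ℕ → Set
  NimSum y z = y ≤ g₋ₛ z → grundy g₋ₛ y z ≡ y ⊕ z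
  nim-sum : ∀ y z → (∀ {v w} → Move g₋ₛ y z v w → NimSum v w) → NimSum y z
  nim-sum y z ih y≤g₋ₛz with shiftSplit s z
  ... | below z<s = grundy-initial g-mono shifted z<s (subst (y ≤_) (g₋ₛ-below z<s) y≤g₋ₛz)
  ... | above z′  = grundy-shifted g-mono shifted (subst (y ≤_) (g₋ₛ-above z′) y≤g₋ₛz)
                      (λ mv → ih mv (Move-≤ g₋ₛ y≤g₋ₛz mv))
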